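{- Let $n \ge 5$ and let $M_n$ be the matching complex of the complete graph $K_n$, and put $\nu_n=\lfloor \frac{n+1}{3}\rfloor - 1$. There is a gradient vector field on $M_n$ with respect to which there are no critical simplices of dimension up to (and including) $\nu_n-1$, except exactly one critical $0$-simplex.
   Context: The matching complex $M_n$ is the abstract simplicial complex whose vertex set is the edge set of $K_n$ and whose simplices are the matchings of $K_n$ (sets of pairwise vertex-disjoint edges), including the empty matching; a matching with $d+1$ edges is a $d$-simplex. A discrete vector field $\mathscr{V}$ on a simplicial complex $\mathcal{K}$ is a set of ordered pairs $(\alpha,\beta)$ of simplices of $\mathcal{K}$ (the empty simplex allowed) with $\alpha\subsetneq\beta$, $\dim\beta=\dim\alpha+1$, such that each simplex lies in at most one pair. A $\mathscr{V}$-path is a sequence $\alpha_0,\beta_0,\alpha_1,\beta_1,\dots,\alpha_k,\beta_k,\alpha_{k+1}$ of simplices of dimensions $d,d+1,d,\dots$ with $(\alpha_i,\beta_i)\in\mathscr{V}$ and $\beta_i\supsetneq\alpha_{i+1}\neq\alpha_i$ for all $i$; it is a nontrivial closed path if $k\ge 0$ and $\alpha_{k+1}=\alpha_0$. A gradient vector field is a discrete vector field admitting no nontrivial closed paths. A nonempty simplex $\alpha$ is critical with respect to $\mathscr{V}$ if either $\alpha$ appears in no pair of $\mathscr{V}$, or $\alpha$ is a $0$-simplex and $(\emptyset,\alpha)\in\mathscr{V}$. -}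

module Defs where

open import Data.Nat using (ℕ; zero; suc; _+_; _∸_; _≤_; _<_)
open import Data.Nat.DivMod using (_/_)
open import Data.Bool using (Bool; true; false; if_then_else_)
open import Data.Fin using (Fin)
import Data.Fin as F
open import Data.Vec using (Vec; lookup; foldr)
open import Data.Product using (_×_; _,_; ∃; ∃-syntax; Σ)
open import Data.Sum using (_⊎_)
open import Relation.Binary.PropositionalEquality using (_≡_; _≢_)
open import Relation.Nullary using (¬_)

-- A set of edges of K_n.  Vertices of K_n are Fin n; the edge {i,j} with
-- i < j is encoded by the entry (i , j) of an n×n Boolean matrix.
EdgeSet : ℕ → Set
EdgeSet n = Vec (Vec Bool n) n

_∋_ : ∀ {n} → EdgeSet n → Fin n × Fin n → Set
S ∋ (i , j) = lookup (lookup S i) j ≡ true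

-- number of edges in an edge set (= dimension + 1 of the simplex)
countRow : ∀ {n} → Vec Bool n → ℕ
countRow = foldr _ (λ b r → (if b then 1 else 0) + r) 0

size : ∀ {n} → EdgeSet n → ℕ
size = foldr _ (λ row r → countRow row + r) 0

empty : ∀ {n} → EdgeSet n
empty = Data.Vec.replicate _ (Data.Vec.replicate _ false)

IsMatching : ∀ {n} → EdgeSet n → Set
IsMatching {n} S =
  (∀ (i j : Fin n) → S ∋ (i , j) → i F.< j)
  × (∀ (i j k l : Fin n) → S ∋ (i , j) → S ∋ (k , l) → (i , j) ≢ (k , l) →
       (i ≢ k) × (i ≢ l) × (j ≢ k) × (j ≢ l))

_⊆_ : ∀ {n} → EdgeSet n → EdgeSet n → Set
_⊆_ {n} A B = ∀ (i j : Fin n) → A ∋ (i , j) → B ∋ (i , j)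

_⊊_ : ∀ {n} → EdgeSet n → EdgeSet n → Set
A ⊊ B = (A ⊆ B) × (A ≢ B)

PairSet : ℕ → Set₁
PairSet n = EdgeSet n → EdgeSet n → Set

InPair : ∀ {n} → EdgeSet n → EdgeSet n → EdgeSet n → Set
InPair σ α β = (σ ≡ α) ⊎ (σ ≡ β)

IsDiscreteVectorField : ∀ {n} → PairSet n → Set
IsDiscreteVectorField {n} V =
  (∀ α β → V α β →
     IsMatching α × IsMatching β × (α ⊊ β) × (size β ≡ suc (size α)))
  × (∀ (σ α β α' β' : EdgeSet n) → V α β → V α' β' →
       InPair σ α β → InPair σ α' β' → (α ≡ α') × (β ≡ β'))

-- a nontrivial closed V-path α₀,β₀,…,α_k,β_k,α_{k+1}=α₀ (k ≥ 0),
-- all α_i of one common size d (dimension d-1)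
ClosedPath : ∀ {n} → PairSet n → Set
ClosedPath {n} V =
  Σ ℕ λ k → Σ (ℕ → EdgeSet n) λ α → Σ (ℕ → EdgeSet n) λ β → Σ ℕ λ d →
    (∀ i → i ≤ suc k → size (α i) ≡ d)
    × (∀ i → i ≤ k →
         V (α i) (β i) × (α (suc i) ⊊ β i) × (α (suc i) ≢ α i))
    × (α (suc k) ≡ α 0)

IsGradientVectorField : ∀ {n} → PairSet n → Set
IsGradientVectorField V = IsDiscreteVectorField V × ¬ ClosedPath V

Critical : ∀ {n} → PairSet n → EdgeSet n → Set
Critical {n} V α =
  IsMatching α × (1 ≤ size α) ×
  ( (¬ (∃[ β ] V α β) × ¬ (∃[ γ ] V γ α))
  ⊎ ((size α ≡ 1) × V empty α))

ν : ℕ → ℕ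
ν n = (suc n / 3) ∸ 1

-- Split the vertices of K_n into the blocks {3t, 3t+1, 3t+2}. A matching α is paired with α ± e,
-- where e is an edge of the triangle on the first block of α that is not critical; inside a block
-- the pairing is the iterated element matching on the edges ab, bc, ac, and a block is critical
-- when none of them can be toggled, which forces at least two of its vertices to be covered.
-- Along a V-path the indicator of "block t contains an edge of the matching" increases
-- colexicographically, so the field is acyclic. A critical matching other than the partner {01}
-- of the empty matching has every block critical, hence covers at least 2⌊(n+1)/3⌋ − 1 vertices
-- and has more than ν_n edges.
module Submission where

open import Defs
open import Data.Bool using (Bool; true; false; not; _∧_; _∨_; if_then_else_)
import Data.Bool as Bool
open import Data.Bool.Properties using (∨-zeroʳ; ¬-not)
open import Data.Empty using (⊥; ⊥-elim)
open import Data.Fin using (Fin; toℕ; fromℕ<)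
import Data.Fin as Fin
open import Data.Fin.Properties using (any?; toℕ-fromℕ<; toℕ<n; toℕ-injective)
open import Data.Nat using (ℕ; zero; suc; _+_; _*_; _∸_; _≤_; _<_; z≤n; s≤s)
open import Data.Nat.DivMod using (_/_; +-distrib-/-∣ʳ; m<n⇒m/n≡0; m*n/n≡m; m/n*n≤m; /-monoˡ-≤)
open import Data.Nat.Divisibility using (m∣m*n)
open import Data.Nat.Properties
open import Algebra.Properties.CommutativeSemigroup +-commutativeSemigroup using (interchange)
open import Data.Product using (_×_; _,_; proj₁; proj₂; Σ; ∃-syntax)
import Data.Product
open import Data.Product.Properties using (≡-dec)
open import Data.Sum using (_⊎_; inj₁; inj₂)
open import Data.Vec using (Vec; []; _∷_; lookup; tabulate)
import Data.Vec
open import Data.Vec.Properties using (lookup∘tabulate; tabulate∘lookup; tabulate-cong; lookup-replicate)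
open import Function.Base using (_∘_; case_of_)
open import Function.Bundles using (mk⇔)
open import Relation.Binary.Definitions using (DecidableEquality; tri<; tri≈; tri>)
open import Relation.Binary.PropositionalEquality
open import Relation.Nullary using (¬_; Dec; yes; no)
open import Relation.Nullary.Decidable using (does; dec-true; dec-false; does-⇔; _⊎-dec_)


∑ : ℕ → (ℕ → ℕ) → ℕ
∑ zero    f = 0
∑ (suc k) f = ∑ k f + f k

syntax ∑ k (λ i → e) = ∑[ i < k ] e

private
  false≢true : false ≢ true
  false≢true ()

  true≢false : true ≢ false
  true≢false ()

  both-false : ∀ {x y} → x ≢ true → y ≢ true → x ≡ y
  both-false x≢true y≢true = trans (¬-not x≢true) (sym (¬-not y≢true))

  <-suc : ∀ {i k} → i < k → i < suc k
  <-suc = m<n⇒m<1+n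

∑-cong : ∀ k {f g} → (∀ i → i < k → f i ≡ g i) → ∑ k f ≡ ∑ k g
∑-cong zero    h = refl
∑-cong (suc k) h = cong₂ _+_ (∑-cong k (λ i i<k → h i (<-suc i<k))) (h k ≤-refl)

∑-mono : ∀ k {f g} → (∀ i → i < k → f i ≤ g i) → ∑ k f ≤ ∑ k g
∑-mono zero    h = z≤n
∑-mono (suc k) h = +-mono-≤ (∑-mono k (λ i i<k → h i (<-suc i<k))) (h k ≤-refl)

∑-+ : ∀ k f g → ∑[ i < k ] (f i + g i) ≡ ∑ k f + ∑ k g
∑-+ zero    f g = refl
∑-+ (suc k) f g = trans (cong (_+ (f k + g k)) (∑-+ k f g)) (interchange (∑ k f) (∑ k g) (f k) (g k))

∑-zero : ∀ k → ∑[ i < k ] 0 ≡ 0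
∑-zero zero    = refl
∑-zero (suc k) = cong (_+ 0) (∑-zero k)

∑-swap : ∀ k m (F : ℕ → ℕ → ℕ) → ∑[ i < k ] ∑[ j < m ] F i j ≡ ∑[ j < m ] ∑[ i < k ] F i j
∑-swap zero    m F = sym (∑-zero m)
∑-swap (suc k) m F = begin
  ∑[ i < k ] ∑[ j < m ] F i j + ∑[ j < m ] F k j  ≡⟨ cong (_+ ∑[ j < m ] F k j) (∑-swap k m F) ⟩
  ∑[ j < m ] ∑[ i < k ] F i j + ∑[ j < m ] F k j  ≡⟨ ∑-+ m (λ j → ∑[ i < k ] F i j) (λ j → F k j) ⟨
  ∑[ j < m ] (∑[ i < k ] F i j + F k j)           ∎
  where open ≡-Reasoning

∑-head : ∀ k f → ∑ (suc k) f ≡ f 0 + ∑[ i < k ] f (suc i)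
∑-head zero    f = +-comm 0 (f 0)
∑-head (suc k) f = trans (cong (_+ f (suc k)) (∑-head k f)) (+-assoc (f 0) _ _)

∑-≤-range : ∀ {k m} f → k ≤ m → ∑ k f ≤ ∑ m f
∑-≤-range {k} f k≤m with m≤n⇒∃[o]m+o≡n k≤m
... | j , refl = ∑-extend k j
  where
  ∑-extend : ∀ m k → ∑ m f ≤ ∑ (m + k) f
  ∑-extend m zero    rewrite +-identityʳ m = ≤-refl
  ∑-extend m (suc k) rewrite +-suc m k = ≤-trans (∑-extend m k) (m≤m+n _ _)

∑-term : ∀ k f {i} → i < k → f i ≤ ∑ k f
∑-term (suc k) f {i} i<1+k with m≤n⇒m<n∨m≡n (≤-pred i<1+k)
... | inj₁ i<k  = ≤-trans (∑-term k f i<k) (m≤m+n _ _)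
... | inj₂ refl = m≤n+m _ _

private
  +-≤-≡ : ∀ {a b c d} → a ≤ b → c ≤ d → a + c ≡ b + d → a ≡ b × c ≡ d
  +-≤-≡ {a} {b} {c} {d} a≤b c≤d eq = a≡b , +-cancelˡ-≡ a c d (trans eq (cong (_+ d) (sym a≡b)))
    where
    a≡b : a ≡ b
    a≡b = ≤-antisym a≤b (+-cancelʳ-≤ d b a (≤-trans (≤-reflexive (sym eq)) (+-monoʳ-≤ a c≤d)))

∑-≤-≡ : ∀ k {f g} → (∀ i → i < k → f i ≤ g i) → ∑ k f ≡ ∑ k g → ∀ i → i < k → f i ≡ g i
∑-≤-≡ (suc k) {f} {g} f≤g eq i i<1+k
  with +-≤-≡ (∑-mono k (λ j j<k → f≤g j (<-suc j<k))) (f≤g k ≤-refl) eq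
     | m≤n⇒m<n∨m≡n (≤-pred i<1+k)
... | eq-init , _ | inj₁ i<k  = ∑-≤-≡ k (λ j j<k → f≤g j (<-suc j<k)) eq-init i i<k
... | _ , eq-last | inj₂ refl = eq-last

∑-suc-at : ∀ k {f g} p → p < k → g p ≡ suc (f p) → (∀ i → i < k → i ≢ p → f i ≡ g i) →
           ∑ k g ≡ suc (∑ k f)
∑-suc-at (suc k) {f} {g} p p<1+k gp rest with m≤n⇒m<n∨m≡n (≤-pred p<1+k)
... | inj₁ p<k = begin
  ∑ k g + g k        ≡⟨ cong₂ _+_ (∑-suc-at k p p<k gp (λ i i<k → rest i (<-suc i<k)))
                                  (sym (rest k ≤-refl (λ k≡p → <-irrefl (sym k≡p) p<k))) ⟩
  suc (∑ k f) + f k  ∎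
  where open ≡-Reasoning
... | inj₂ refl = begin
  ∑ p g + g p        ≡⟨ cong₂ _+_ (∑-cong p (λ i i<p → sym (rest i (<-suc i<p) (<⇒≢ i<p)))) gp ⟩
  ∑ p f + suc (f p)  ≡⟨ +-suc (∑ p f) (f p) ⟩
  suc (∑ p f + f p)  ∎
  where open ≡-Reasoning

∑-triples : ∀ k f → (∀ t → t < k → 2 ≤ f (3 * t) + f (1 + 3 * t) + f (2 + 3 * t)) → 2 * k ≤ ∑ (3 * k) f
∑-triples zero    f h = z≤n
∑-triples (suc k) f h = begin
  2 * suc k                                                ≡⟨ *-suc 2 k ⟩
  2 + 2 * k                                                ≤⟨ +-mono-≤ (h k ≤-refl) (∑-triples k f (λ t t<k → h t (<-suc t<k))) ⟩
  f (3 * k) + f (1 + 3 * k) + f (2 + 3 * k) + ∑ (3 * k) f  ≡⟨ regroup (∑ (3 * k) f) (f (3 * k)) _ _ ⟩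
  ∑ (3 + 3 * k) f                                          ≡⟨ cong (λ m → ∑ m f) (*-suc 3 k) ⟨
  ∑ (3 * suc k) f                                          ∎
  where
  open ≤-Reasoning
  regroup : ∀ s a b c → a + b + c + s ≡ s + a + b + c
  regroup s a b c = trans (+-comm (a + b + c) s) (trans (sym (+-assoc s (a + b) c)) (cong (_+ c) (sym (+-assoc s a b))))

least-unique : ∀ {p} {P : ℕ → Set p} {t t′} →
               (∀ s → s < t → P s) → ¬ P t → (∀ s → s < t′ → P s) → ¬ P t′ → t ≡ t′
least-unique {t = t} {t′} below ¬Pt below′ ¬Pt′ with <-cmp t t′
... | tri< t<t′ _ _ = ⊥-elim (¬Pt (below′ t t<t′))
... | tri≈ _ t≡t′ _ = t≡t′
... | tri> _ _ t′<t = ⊥-elim (¬Pt′ (below t′ t′<t))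

infix 4 _<colex_

_<colex_ : (ℕ → Bool) → (ℕ → Bool) → Set
h <colex h′ = ∃[ t ] h t ≡ false × h′ t ≡ true × (∀ s → t < s → h s ≡ h′ s)

<colex-irrefl : ∀ h → ¬ h <colex h
<colex-irrefl h (t , ht≡false , ht≡true , _) = false≢true (trans (sym ht≡false) ht≡true)

<colex-trans : ∀ {h h′ h″} → h <colex h′ → h′ <colex h″ → h <colex h″
<colex-trans (t , ht , h′t , above) (t′ , h′t′ , h″t′ , above′) with <-cmp t t′
... | tri< t<t′ _ _ = t′ , trans (above t′ t<t′) h′t′ , h″t′ ,
                      λ s t′<s → trans (above s (<-trans t<t′ t′<s)) (above′ s t′<s)
... | tri≈ _ refl _ = ⊥-elim (false≢true (trans (sym h′t′) h′t))
... | tri> _ _ t′<t = t , ht , trans (sym (above′ t t′<t)) h′t ,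
                      λ s t<s → trans (above s t<s) (above′ s (<-trans t′<t t<s))

data Side : Set where
  AB BC AC : Side

record Local : Set where
  constructor block
  field
    edgeAB edgeBC edgeAC : Bool
    busyA busyB busyC    : Bool

open Local

edge : Local → Side → Bool
edge l AB = edgeAB l
edge l BC = edgeBC l
edge l AC = edgeAC l

Busy Free : Local → Side → Set
Busy l AB = busyA l ≡ true × busyB l ≡ true
Busy l BC = busyB l ≡ true × busyC l ≡ true
Busy l AC = busyA l ≡ true × busyC l ≡ true
Free l AB = busyA l ≡ false × busyB l ≡ false
Free l BC = busyB l ≡ false × busyC l ≡ false
Free l AC = busyA l ≡ false × busyC l ≡ false

add del : Local → Side → Local
add l AB = record l { edgeAB = true ; busyA = true ; busyB = true }
add l BC = record l { edgeBC = true ; busyB = true ; busyC = true }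
add l AC = record l { edgeAC = true ; busyA = true ; busyC = true }
del l AB = record l { edgeAB = false ; busyA = false ; busyB = false }
del l BC = record l { edgeBC = false ; busyB = false ; busyC = false }
del l AC = record l { edgeAC = false ; busyA = false ; busyC = false }

hasInternal lower upper critical : Local → Bool
hasInternal l = edgeAB l ∨ edgeBC l ∨ edgeAC l
lower l = not (hasInternal l) ∧ not (busyA l ∧ busyB l ∨ busyA l ∧ busyC l ∨ busyB l ∧ busyC l)
upper l = edgeAB l ∨ edgeBC l ∧ busyA l ∨ edgeAC l ∧ busyB l
critical l = not (lower l ∨ upper l)

-- The element matchings on ab, bc and ac, tried in this order.
pick up : Local → Side
pick l = if busyA l then BC else if busyB l then AC else AB
up l = if edgeAB l then AB else if edgeBC l then BC else AC

SingleEdge EdgesBusy : Local → Set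
SingleEdge l = ∀ s s′ → edge l s ≡ true → edge l s′ ≡ true → s ≡ s′
EdgesBusy l = ∀ s → edge l s ≡ true → Busy l s

ind : Bool → ℕ
ind b = if b then 1 else 0

ind≤1 : ∀ b → ind b ≤ 1
ind≤1 false = z≤n
ind≤1 true  = ≤-refl

ind-mono : ∀ {a b} → (a ≡ true → b ≡ true) → ind a ≤ ind b
ind-mono {false} _   = z≤n
ind-mono {true}  a⇒b rewrite a⇒b refl = ≤-refl

ind-injective : ∀ {a b} → ind a ≡ ind b → a ≡ b
ind-injective {false} {false} _ = refl
ind-injective {true}  {true}  _ = refl

data LowerShape : Local → Set where
  allFree : ∀ c → LowerShape (block false false false false false c)
  onlyA   : LowerShape (block false false false true  false false)
  onlyB   : LowerShape (block false false false false true  false)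

lower-shape : ∀ l → lower l ≡ true → LowerShape l
lower-shape (block false false false false false c)     _ = allFree c
lower-shape (block false false false true  false false) _ = onlyA
lower-shape (block false false false false true  false) _ = onlyB
lower-shape (block false false false false true  true)  ()
lower-shape (block false false false true  true  _)     ()
lower-shape (block false false false true  false true)  ()
lower-shape (block true  _     _     _     _     _)     ()
lower-shape (block false true  _     _     _     _)     ()
lower-shape (block false false true  _     _     _)     ()

data UpperShape : Local → Set where
  withAB : ∀ a b c → UpperShape (block true  false false a    b    c)
  withBC : ∀ b c   → UpperShape (block false true  false true b    c)
  withAC : ∀ a c   → UpperShape (block false false true  a    true c)

upper-shape : ∀ l → SingleEdge l → upper l ≡ true → UpperShape l
upper-shape (block true  false false a     b     c) _ _ = withAB a b c
upper-shape (block false true  false true  b     c) _ _ = withBC b c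
upper-shape (block false false true  a     true  c) _ _ = withAC a c
upper-shape (block true  true  _     _     _     _) single _ with () ← single AB BC refl refl
upper-shape (block true  false true  _     _     _) single _ with () ← single AB AC refl refl
upper-shape (block false true  true  _     _     _) single _ with () ← single BC AC refl refl
upper-shape (block false true  false false _     _) _ ()
upper-shape (block false false true  _     false _) _ ()
upper-shape (block false false false _     _     _) _ ()

lower-free : ∀ l → lower l ≡ true → Free l (pick l)
lower-free l L with lower-shape l L
... | allFree c = refl , refl
... | onlyA     = refl , refl
... | onlyB     = refl , refl

lower-add-upper : ∀ l → lower l ≡ true → upper (add l (pick l)) ≡ true × up (add l (pick l)) ≡ pick l
lower-add-upper l L with lower-shape l L
... | allFree c = refl , refl
... | onlyA     = refl , refl
... | onlyB     = refl , refl

lower⇒¬upper : ∀ l → lower l ≡ true → upper l ≡ false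
lower⇒¬upper l L with lower-shape l L
... | allFree c = refl
... | onlyA     = refl
... | onlyB     = refl

lower⇒¬internal : ∀ l → lower l ≡ true → hasInternal l ≡ false
lower⇒¬internal l L with lower-shape l L
... | allFree c = refl
... | onlyA     = refl
... | onlyB     = refl

upper-del-lower : ∀ l → SingleEdge l → upper l ≡ true → lower (del l (up l)) ≡ true × pick (del l (up l)) ≡ up l
upper-del-lower l single U with upper-shape l single U
... | withAB a b c = refl , refl
... | withBC b c   = refl , refl
... | withAC a c   = refl , refl

upper-edge : ∀ l → SingleEdge l → upper l ≡ true → edge l (up l) ≡ true
upper-edge l single U with upper-shape l single U
... | withAB a b c = refl
... | withBC b c   = refl
... | withAC a c   = refl

edge⇒internal : ∀ l s → edge l s ≡ true → hasInternal l ≡ true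
edge⇒internal (block true  _     _    _ _ _) AB _ = refl
edge⇒internal (block false true  _    _ _ _) BC _ = refl
edge⇒internal (block true  true  _    _ _ _) BC _ = refl
edge⇒internal (block ab    bc    true _ _ _) AC _ with ab | bc
... | true  | _     = refl
... | false | true  = refl
... | false | false = refl

lower⇒noncritical : ∀ l → lower l ≡ true → critical l ≡ false
lower⇒noncritical l L rewrite L = refl

upper⇒noncritical : ∀ l → upper l ≡ true → critical l ≡ false
upper⇒noncritical l U rewrite U | ∨-zeroʳ (lower l) = refl

critical⇒two-busy : ∀ l → EdgesBusy l → critical l ≡ true → 2 ≤ ind (busyA l) + ind (busyB l) + ind (busyC l)
critical⇒two-busy (block false false false true  true  c)    _ _ = m≤m+n 2 (ind c)
critical⇒two-busy (block false false false true  false true) _ _ = s≤s (s≤s z≤n)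
critical⇒two-busy (block false false false false true  true) _ _ = s≤s (s≤s z≤n)
critical⇒two-busy (block false false false false false _)    _ ()
critical⇒two-busy (block false false false true  false false) _ ()
critical⇒two-busy (block false false false false true  false) _ ()
critical⇒two-busy (block true _ _ _ _ _) _ ()
critical⇒two-busy (block false true ac a b c) busy _ with busy BC refl
critical⇒two-busy (block false true ac true  _ _) _ _ | refl , refl = s≤s (s≤s z≤n)
critical⇒two-busy (block false true ac false _ _) _ _ | refl , refl = s≤s (s≤s z≤n)
critical⇒two-busy (block false false true a b c) busy _ with busy AC refl
critical⇒two-busy (block false false true _ true  _) _ _ | refl , refl = s≤s (s≤s z≤n)
critical⇒two-busy (block false false true _ false _) _ _ | refl , refl = s≤s (s≤s z≤n)

Graph : Set
Graph = ℕ × ℕ → Bool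

infix 4 _⊑_

_⊑_ : Graph → Graph → Set
A ⊑ B = ∀ {x} → A x ≡ true → B x ≡ true

_≟ₑ_ : DecidableEquality (ℕ × ℕ)
_≟ₑ_ = ≡-dec _≟_ _≟_

-- Opaque, so that the graph A in `A [ e ]≔ b` (and in `busy A v` below) is inferable by unification.
opaque
  _[_]≔_ : Graph → ℕ × ℕ → Bool → Graph
  (A [ e ]≔ b) x = if does (x ≟ₑ e) then b else A x

  update-hit : ∀ {A e b} → (A [ e ]≔ b) e ≡ b
  update-hit {e = e} with e ≟ₑ e
  ... | yes _   = refl
  ... | no  e≢e = ⊥-elim (e≢e refl)

  update-miss : ∀ {A e b x} → x ≢ e → (A [ e ]≔ b) x ≡ A x
  update-miss {e = e} {x = x} x≢e with x ≟ₑ e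
  ... | yes x≡e = ⊥-elim (x≢e x≡e)
  ... | no  _   = refl

  update-true : ∀ {A e b x} → (A [ e ]≔ b) x ≡ true → x ≡ e × b ≡ true ⊎ x ≢ e × A x ≡ true
  update-true {e = e} {x = x} h with x ≟ₑ e
  ... | yes x≡e = inj₁ (x≡e , h)
  ... | no  x≢e = inj₂ (x≢e , h)

  update-cong : ∀ {A B} → A ≗ B → ∀ e b → A [ e ]≔ b ≗ B [ e ]≔ b
  update-cong A≗B e b x with x ≟ₑ e
  ... | yes _ = refl
  ... | no  _ = A≗B x

  update-restore : ∀ {A e b b′} → A e ≡ b → (A [ e ]≔ b′) [ e ]≔ b ≗ A
  update-restore {A} {e} Ae x with x ≟ₑ e
  ... | yes refl = sym Ae
  ... | no  x≢e  = refl

⊑-insert : ∀ {A e} → A ⊑ A [ e ]≔ true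
⊑-insert {e = e} {x} Ax with x ≟ₑ e
... | yes refl = update-hit
... | no  x≢e  = trans (update-miss x≢e) Ax

pair-≢ˡ : ∀ {x x′ y y′ : ℕ} → x ≢ x′ → (x , y) ≢ (x′ , y′)
pair-≢ˡ x≢x′ eq = x≢x′ (cong proj₁ eq)

pair-≢ʳ : ∀ {x x′ y y′ : ℕ} → y ≢ y′ → (x , y) ≢ (x′ , y′)
pair-≢ʳ y≢y′ eq = y≢y′ (cong proj₂ eq)

Incident : Graph → ℕ → ℕ → Set
Incident A v w = A (v , w) ≡ true ⊎ A (w , v) ≡ true

record Matching (A : Graph) : Set where
  field
    ordered        : ∀ {i j} → A (i , j) ≡ true → i < j
    partner-unique : ∀ {v w w′} → Incident A v w → Incident A v w′ → w ≡ w′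

open Matching

matching-≗ : ∀ {A B} → A ≗ B → Matching A → Matching B
matching-≗ {A} {B} A≗B M = record
  { ordered        = λ h → ordered M (trans (A≗B _) h)
  ; partner-unique = λ h h′ → partner-unique M (back h) (back h′)
  }
  where
  back : ∀ {v w} → Incident B v w → Incident A v w
  back (inj₁ h) = inj₁ (trans (A≗B _) h)
  back (inj₂ h) = inj₂ (trans (A≗B _) h)

edgeless-matching : Matching (λ _ → false)
edgeless-matching = record { ordered = λ () ; partner-unique = λ { (inj₁ ()) ; (inj₂ ()) } }

Isolated : Graph → ℕ → Set
Isolated A v = ∀ w → ¬ Incident A v w

Agree : Graph → Graph → ℕ → Set
Agree A B v = ∀ w → A (v , w) ≡ B (v , w) × A (w , v) ≡ B (w , v)

≗⇒agree : ∀ {A B} → A ≗ B → ∀ v → Agree A B v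
≗⇒agree A≗B v w = A≗B (v , w) , A≗B (w , v)

update-agree : ∀ {A p q b v} → v ≢ p → v ≢ q → Agree (A [ (p , q) ]≔ b) A v
update-agree v≢p v≢q w = update-miss (pair-≢ˡ v≢p) , update-miss (pair-≢ʳ v≢q)

module _ {A : Graph} {p q : ℕ} where

  deleted-true : ∀ {x} → (A [ (p , q) ]≔ false) x ≡ true → A x ≡ true
  deleted-true h with update-true h
  ... | inj₂ (_ , Ax) = Ax

  incident-insert : ∀ {v w} → Incident (A [ (p , q) ]≔ true) v w →
                    Incident A v w ⊎ (v ≡ p × w ≡ q ⊎ v ≡ q × w ≡ p)
  incident-insert (inj₁ h) with update-true h
  ... | inj₁ (refl , _) = inj₂ (inj₁ (refl , refl))
  ... | inj₂ (_ , Avw)  = inj₁ (inj₁ Avw)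
  incident-insert (inj₂ h) with update-true h
  ... | inj₁ (refl , _) = inj₂ (inj₂ (refl , refl))
  ... | inj₂ (_ , Awv)  = inj₁ (inj₂ Awv)

  incident-delete : ∀ {v w} → Incident (A [ (p , q) ]≔ false) v w → Incident A v w
  incident-delete (inj₁ h) = inj₁ (deleted-true h)
  incident-delete (inj₂ h) = inj₂ (deleted-true h)

  insert-matching : Matching A → p < q → Isolated A p → Isolated A q → Matching (A [ (p , q) ]≔ true)
  insert-matching M p<q iso-p iso-q = record { ordered = ordered′ ; partner-unique = unique′ }
    where
    ordered′ : ∀ {i j} → (A [ (p , q) ]≔ true) (i , j) ≡ true → i < j
    ordered′ h with update-true h
    ... | inj₁ (refl , _) = p<q
    ... | inj₂ (_ , Aij)  = ordered M Aij
    unique′ : ∀ {v w w′} → Incident (A [ (p , q) ]≔ true) v w → Incident (A [ (p , q) ]≔ true) v w′ → w ≡ w′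
    unique′ h h′ with incident-insert h | incident-insert h′
    ... | inj₁ i                 | inj₁ i′                = partner-unique M i i′
    ... | inj₁ i                 | inj₂ (inj₁ (refl , _)) = ⊥-elim (iso-p _ i)
    ... | inj₁ i                 | inj₂ (inj₂ (refl , _)) = ⊥-elim (iso-q _ i)
    ... | inj₂ (inj₁ (refl , _)) | inj₁ i′                = ⊥-elim (iso-p _ i′)
    ... | inj₂ (inj₂ (refl , _)) | inj₁ i′                = ⊥-elim (iso-q _ i′)
    ... | inj₂ (inj₁ (_ , refl)) | inj₂ (inj₁ (_ , refl)) = refl
    ... | inj₂ (inj₂ (_ , refl)) | inj₂ (inj₂ (_ , refl)) = refl
    ... | inj₂ (inj₁ (refl , _)) | inj₂ (inj₂ (v≡q , _))  = ⊥-elim (<⇒≢ p<q v≡q)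
    ... | inj₂ (inj₂ (refl , _)) | inj₂ (inj₁ (v≡p , _))  = ⊥-elim (<⇒≢ p<q (sym v≡p))

  delete-matching : Matching A → Matching (A [ (p , q) ]≔ false)
  delete-matching M = record
    { ordered        = λ h → ordered M (deleted-true h)
    ; partner-unique = λ h h′ → partner-unique M (incident-delete h) (incident-delete h′)
    }

  delete-isolates : Matching A → A (p , q) ≡ true → Isolated (A [ (p , q) ]≔ false) p × Isolated (A [ (p , q) ]≔ false) q
  delete-isolates M Apq = iso-p , iso-q
    where
    iso-p : Isolated (A [ (p , q) ]≔ false) p
    iso-p w (inj₁ h) with update-true h
    ... | inj₂ (pw≢pq , Apw) = pw≢pq (cong (p ,_) (partner-unique M (inj₁ Apw) (inj₁ Apq)))
    iso-p w (inj₂ h) with update-true h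
    ... | inj₂ (_ , Awp) with partner-unique M (inj₂ Awp) (inj₁ Apq)
    ...   | refl = <-asym (ordered M Apq) (ordered M Awp)
    iso-q : Isolated (A [ (p , q) ]≔ false) q
    iso-q w (inj₂ h) with update-true h
    ... | inj₂ (wq≢pq , Awq) = wq≢pq (cong (_, q) (partner-unique M (inj₂ Awq) (inj₂ Apq)))
    iso-q w (inj₁ h) with update-true h
    ... | inj₂ (_ , Aqw) with partner-unique M (inj₁ Aqw) (inj₂ Apq)
    ...   | refl = <-asym (ordered M Apq) (ordered M Aqw)

Bounded : ℕ → Graph → Set
Bounded n A = ∀ {i j} → A (i , j) ≡ true → i < n × j < n

count : ℕ → Graph → ℕ
count n A = ∑[ i < n ] ∑[ j < n ] ind (A (i , j))

module _ (n : ℕ) {A A′ : Graph} where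

  count-suc-at : ∀ {p q} → p < n → q < n → A (p , q) ≡ false → A′ (p , q) ≡ true →
                 (∀ x → x ≢ (p , q) → A x ≡ A′ x) → count n A′ ≡ suc (count n A)
  count-suc-at {p} {q} p<n q<n Apq A′pq elsewhere = ∑-suc-at n p p<n row-p other-rows
    where
    row-p : ∑[ j < n ] ind (A′ (p , j)) ≡ suc (∑[ j < n ] ind (A (p , j)))
    row-p = ∑-suc-at n q q<n (trans (cong ind A′pq) (cong (suc ∘ ind) (sym Apq)))
                     (λ j _ j≢q → cong ind (elsewhere (p , j) (pair-≢ʳ j≢q)))
    other-rows : ∀ i → i < n → i ≢ p → ∑[ j < n ] ind (A (i , j)) ≡ ∑[ j < n ] ind (A′ (i , j))
    other-rows i _ i≢p = ∑-cong n (λ j _ → cong ind (elsewhere (i , j) (pair-≢ˡ i≢p)))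

  count-⊑-≡ : Bounded n A′ → A ⊑ A′ → count n A ≡ count n A′ → A ≗ A′
  count-⊑-≡ bounded A⊑A′ eq (i , j) with i <? n | j <? n
  ... | yes i<n | yes j<n = ind-injective (∑-≤-≡ n (λ j _ → ind-mono A⊑A′) (∑-≤-≡ n rows≤ eq i i<n) j j<n)
    where
    rows≤ : ∀ i → i < n → ∑[ j < n ] ind (A (i , j)) ≤ ∑[ j < n ] ind (A′ (i , j))
    rows≤ i _ = ∑-mono n (λ j _ → ind-mono A⊑A′)
  ... | no i≮n | _ = both-false (i≮n ∘ proj₁ ∘ bounded ∘ A⊑A′) (i≮n ∘ proj₁ ∘ bounded)
  ... | yes _ | no j≮n = both-false (j≮n ∘ proj₂ ∘ bounded ∘ A⊑A′) (j≮n ∘ proj₂ ∘ bounded)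

count-≗ : ∀ n {A B} → A ≗ B → count n A ≡ count n B
count-≗ n A≗B = ∑-cong n (λ i _ → ∑-cong n (λ j _ → cong ind (A≗B (i , j))))

count-insert : ∀ n {A p q} → p < n → q < n → A (p , q) ≡ false → count n (A [ (p , q) ]≔ true) ≡ suc (count n A)
count-insert n p<n q<n Apq = count-suc-at n p<n q<n Apq update-hit (λ x x≢e → sym (update-miss x≢e))

count-delete : ∀ n {A p q} → p < n → q < n → A (p , q) ≡ true → count n A ≡ suc (count n (A [ (p , q) ]≔ false))
count-delete n p<n q<n Apq = count-suc-at n p<n q<n update-hit Apq (λ x x≢e → update-miss x≢e)

at : ∀ {m} → Vec Bool m → ℕ → Bool
at []       _       = false
at (b ∷ bs) zero    = b
at (b ∷ bs) (suc j) = at bs j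

adjacency : ∀ {k m} → Vec (Vec Bool m) k → Graph
adjacency []       _           = false
adjacency (r ∷ rs) (zero  , j) = at r j
adjacency (r ∷ rs) (suc i , j) = adjacency rs (i , j)

at-lookup : ∀ {m} (bs : Vec Bool m) j → at bs (toℕ j) ≡ lookup bs j
at-lookup (b ∷ bs) Fin.zero    = refl
at-lookup (b ∷ bs) (Fin.suc j) = at-lookup bs j

adjacency-lookup : ∀ {k m} (S : Vec (Vec Bool m) k) i j → adjacency S (toℕ i , toℕ j) ≡ lookup (lookup S i) j
adjacency-lookup (r ∷ rs) Fin.zero    j = at-lookup r j
adjacency-lookup (r ∷ rs) (Fin.suc i) j = adjacency-lookup rs i j

at-bounded : ∀ {m} (bs : Vec Bool m) j → at bs j ≡ true → j < m
at-bounded (b ∷ bs) zero    _ = s≤s z≤n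
at-bounded (b ∷ bs) (suc j) h = s≤s (at-bounded bs j h)

adjacency-bounded : ∀ {n} (S : EdgeSet n) → Bounded n (adjacency S)
adjacency-bounded = go
  where
  go : ∀ {k m} (S : Vec (Vec Bool m) k) {i j} → adjacency S (i , j) ≡ true → i < k × j < m
  go (r ∷ rs) {zero}  {j} h = s≤s z≤n , at-bounded r j h
  go (r ∷ rs) {suc i} h     = Data.Product.map₁ s≤s (go rs h)

∑-rows : ∀ {k m} (S : Vec (Vec Bool m) k) →
         Data.Vec.foldr (λ _ → ℕ) (λ row r → countRow row + r) 0 S ≡ ∑[ i < k ] ∑[ j < m ] ind (adjacency S (i , j))
∑-rows {suc k} {m} (r ∷ rs) = begin
  countRow r + _
    ≡⟨ cong₂ _+_ (∑-row r) (∑-rows rs) ⟩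
  ∑[ j < m ] ind (at r j) + ∑[ i < k ] ∑[ j < m ] ind (adjacency rs (i , j))
    ≡⟨ ∑-head k (λ i → ∑[ j < m ] ind (adjacency (r ∷ rs) (i , j))) ⟨
  ∑[ i < suc k ] ∑[ j < m ] ind (adjacency (r ∷ rs) (i , j))
    ∎
  where
  open ≡-Reasoning
  ∑-row : ∀ {m} (bs : Vec Bool m) → countRow bs ≡ ∑[ j < m ] ind (at bs j)
  ∑-row []       = refl
  ∑-row {suc m} (b ∷ bs) = trans (cong (ind b +_) (∑-row bs)) (sym (∑-head m (λ j → ind (at (b ∷ bs) j))))
∑-rows [] = refl

size≡count : ∀ {n} (S : EdgeSet n) → size S ≡ count n (adjacency S)
size≡count = ∑-rows

toEdgeSet : ∀ {n} → Graph → EdgeSet n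
toEdgeSet A = tabulate λ i → tabulate λ j → A (toℕ i , toℕ j)

module _ {n : ℕ} where

  ∋⇒adjacency : ∀ (S : EdgeSet n) {i j} → S ∋ (i , j) → adjacency S (toℕ i , toℕ j) ≡ true
  ∋⇒adjacency S {i} {j} h = trans (adjacency-lookup S i j) h

  adjacency⇒∋ : ∀ (S : EdgeSet n) {i j} → adjacency S (i , j) ≡ true →
                Σ (Fin n) λ i′ → Σ (Fin n) λ j′ → toℕ i′ ≡ i × toℕ j′ ≡ j × S ∋ (i′ , j′)
  adjacency⇒∋ S {i} {j} h with adjacency-bounded S h
  ... | i<n , j<n = fromℕ< i<n , fromℕ< j<n , toℕ-fromℕ< i<n , toℕ-fromℕ< j<n ,
                    trans (sym (adjacency-lookup S _ _)) (subst₂ (λ a b → adjacency S (a , b) ≡ true) (sym (toℕ-fromℕ< i<n)) (sym (toℕ-fromℕ< j<n)) h)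

  adjacency-injective : ∀ {S T : EdgeSet n} → adjacency S ≗ adjacency T → S ≡ T
  adjacency-injective {S} {T} S≗T =
    vec-ext λ i → vec-ext λ j → trans (sym (adjacency-lookup S i j)) (trans (S≗T _) (adjacency-lookup T i j))
    where
    vec-ext : ∀ {A : Set} {m} {xs ys : Vec A m} → (∀ i → lookup xs i ≡ lookup ys i) → xs ≡ ys
    vec-ext {xs = xs} {ys} h = trans (sym (tabulate∘lookup xs)) (trans (tabulate-cong h) (tabulate∘lookup ys))

  adjacency-toEdgeSet : ∀ {A} → Bounded n A → adjacency (toEdgeSet {n} A) ≗ A
  adjacency-toEdgeSet {A} bounded (i , j) with i <? n | j <? n
  ... | yes i<n | yes j<n = begin
    adjacency T (i , j)                   ≡⟨ cong₂ (λ a b → adjacency T (a , b)) (sym (toℕ-fromℕ< i<n)) (sym (toℕ-fromℕ< j<n)) ⟩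
    adjacency T (toℕ i′ , toℕ j′)         ≡⟨ adjacency-lookup T i′ j′ ⟩
    lookup (lookup T i′) j′               ≡⟨ cong (λ r → lookup r j′) (lookup∘tabulate _ i′) ⟩
    lookup (tabulate λ j → A (toℕ i′ , toℕ j)) j′ ≡⟨ lookup∘tabulate _ j′ ⟩
    A (toℕ i′ , toℕ j′)                   ≡⟨ cong₂ (λ a b → A (a , b)) (toℕ-fromℕ< i<n) (toℕ-fromℕ< j<n) ⟩
    A (i , j)                             ∎
    where
    open ≡-Reasoning
    T = toEdgeSet {n} A
    i′ = fromℕ< i<n
    j′ = fromℕ< j<n
  ... | no i≮n | _ = both-false (i≮n ∘ proj₁ ∘ adjacency-bounded (toEdgeSet A)) (i≮n ∘ proj₁ ∘ bounded)
  ... | yes _ | no j≮n = both-false (j≮n ∘ proj₂ ∘ adjacency-bounded (toEdgeSet A)) (j≮n ∘ proj₂ ∘ bounded)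

  adjacency-⊑⇒⊆ : ∀ {S T : EdgeSet n} → adjacency S ⊑ adjacency T → S ⊆ T
  adjacency-⊑⇒⊆ {S} {T} S⊑T i j h = trans (sym (adjacency-lookup T i j)) (S⊑T (∋⇒adjacency S h))

  ⊆⇒adjacency-⊑ : ∀ {S T : EdgeSet n} → S ⊆ T → adjacency S ⊑ adjacency T
  ⊆⇒adjacency-⊑ {S} {T} S⊆T h with adjacency⇒∋ S h
  ... | i , j , refl , refl , S∋ij = ∋⇒adjacency T (S⊆T i j S∋ij)

  module _ (S : EdgeSet n) where

    private
      Disjoint : ℕ → ℕ → ℕ → ℕ → Set
      Disjoint i j k l = i ≢ k × i ≢ l × j ≢ k × j ≢ l

      toℕ-pair-≢ : ∀ {i j k l : Fin n} → (toℕ i , toℕ j) ≢ (toℕ k , toℕ l) → (i , j) ≢ (k , l)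
      toℕ-pair-≢ ne refl = ne refl

      disjoint : IsMatching S → ∀ {i j k l} → adjacency S (i , j) ≡ true → adjacency S (k , l) ≡ true →
                 (i , j) ≢ (k , l) → Disjoint i j k l
      disjoint M h h′ ne with adjacency⇒∋ S h | adjacency⇒∋ S h′
      ... | i , j , refl , refl , S∋ij | k , l , refl , refl , S∋kl with proj₂ M i j k l S∋ij S∋kl (toℕ-pair-≢ ne)
      ... | i≢k , i≢l , j≢k , j≢l = i≢k ∘ toℕ-injective , i≢l ∘ toℕ-injective , j≢k ∘ toℕ-injective , j≢l ∘ toℕ-injective

    IsMatching⇒Matching : IsMatching S → Matching (adjacency S)
    IsMatching⇒Matching M = record { ordered = ordered′ ; partner-unique = unique′ }
      where
      ordered′ : ∀ {i j} → adjacency S (i , j) ≡ true → i < j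
      ordered′ h with adjacency⇒∋ S h
      ... | i , j , refl , refl , S∋ij = proj₁ M i j S∋ij
      unique′ : ∀ {v w w′} → Incident (adjacency S) v w → Incident (adjacency S) v w′ → w ≡ w′
      unique′ {v} {w} {w′} (inj₁ h) (inj₁ h′) with (v , w) ≟ₑ (v , w′)
      ... | yes eq = cong proj₂ eq
      ... | no ne  = ⊥-elim (proj₁ (disjoint M h h′ ne) refl)
      unique′ {v} {w} {w′} (inj₁ h) (inj₂ h′) with (v , w) ≟ₑ (w′ , v)
      ... | yes eq = trans (cong proj₂ eq) (cong proj₁ eq)
      ... | no ne  = ⊥-elim (proj₁ (proj₂ (disjoint M h h′ ne)) refl)
      unique′ {v} {w} {w′} (inj₂ h) (inj₁ h′) with (w , v) ≟ₑ (v , w′)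
      ... | yes eq = trans (cong proj₁ eq) (cong proj₂ eq)
      ... | no ne  = ⊥-elim (proj₁ (proj₂ (proj₂ (disjoint M h h′ ne))) refl)
      unique′ {v} {w} {w′} (inj₂ h) (inj₂ h′) with (w , v) ≟ₑ (w′ , v)
      ... | yes eq = cong proj₁ eq
      ... | no ne  = ⊥-elim (proj₂ (proj₂ (proj₂ (disjoint M h h′ ne))) refl)

    Matching⇒IsMatching : Matching (adjacency S) → IsMatching S
    Matching⇒IsMatching M = (λ i j S∋ij → ordered M (∋⇒adjacency S S∋ij)) , disjoint′
      where
      disjoint′ : ∀ i j k l → S ∋ (i , j) → S ∋ (k , l) → (i , j) ≢ (k , l) →
                  i ≢ k × i ≢ l × j ≢ k × j ≢ l
      disjoint′ i j k l S∋ij S∋kl ne = i≢k , i≢l , j≢k , j≢l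
        where
        h  = ∋⇒adjacency S S∋ij
        h′ = ∋⇒adjacency S S∋kl
        i≢k : i ≢ k
        i≢k refl = ne (cong (i ,_) (toℕ-injective (partner-unique M (inj₁ h) (inj₁ h′))))
        i≢l : i ≢ l
        i≢l refl with partner-unique M (inj₁ h) (inj₂ h′)
        ... | j≡k = <-asym (ordered M h) (subst (_< toℕ i) (sym j≡k) (ordered M h′))
        j≢k : j ≢ k
        j≢k refl with partner-unique M (inj₂ h) (inj₁ h′)
        ... | i≡l = <-asym (ordered M h) (subst (toℕ j <_) (sym i≡l) (ordered M h′))
        j≢l : j ≢ l
        j≢l refl = ne (cong (_, j) (toℕ-injective (partner-unique M (inj₂ h) (inj₂ h′))))

module BlockMatching (n : ℕ) where

  incident? : ∀ A v w → Dec (Incident A v w)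
  incident? A v w = A (v , w) Bool.≟ true ⊎-dec A (w , v) Bool.≟ true

  degree : Graph → ℕ → ℕ
  degree A v = ∑[ w < n ] (ind (A (v , w)) + ind (A (w , v)))

  opaque
    covered? : ∀ A v → Dec (∃[ w ] Incident A v (toℕ {n} w))
    covered? A v = any? λ w → incident? A v (toℕ w)

    covered : Graph → ℕ → Bool
    covered A v = does (covered? A v)

    -- Vertices ≥ n do not exist in K_n; counting them as busy lets the last block be incomplete.
    busy : Graph → ℕ → Bool
    busy A v = covered A v ∨ does (n ≤? v)

    busy-intro : ∀ {A v w} → w < n → Incident A v w → busy A v ≡ true
    busy-intro {A} {v} w<n inc =
      cong (_∨ does (n ≤? v)) (dec-true (covered? A v) (fromℕ< w<n , subst (Incident A v) (sym (toℕ-fromℕ< w<n)) inc))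

    free⇒< : ∀ {A v} → busy A v ≡ false → v < n
    free⇒< {A} {v} h = ≰⇒> λ n≤v →
      true≢false (trans (sym (trans (cong (covered A v ∨_) (dec-true (n ≤? v) n≤v)) (∨-zeroʳ _))) h)

    free⇒isolated : ∀ {A v} → Bounded n A → busy A v ≡ false → Isolated A v
    free⇒isolated {A} {v} bounded h w inc = true≢false (trans (sym (busy-intro {A} (partner<n inc) inc)) h)
      where
      partner<n : Incident A v w → w < n
      partner<n (inj₁ Avw) = proj₂ (bounded Avw)
      partner<n (inj₂ Awv) = proj₁ (bounded Awv)

    isolated⇒free : ∀ {A v} → v < n → Isolated A v → busy A v ≡ false
    isolated⇒free {A} {v} v<n iso =
      cong₂ _∨_ (dec-false (covered? A v) (λ (w , inc) → iso (toℕ w) inc)) (dec-false (n ≤? v) (<⇒≱ v<n))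

    busy-agree : ∀ {A B v} → Agree A B v → busy A v ≡ busy B v
    busy-agree {A} {B} {v} agree =
      cong (_∨ does (n ≤? v)) (does-⇔ (mk⇔ (λ (w , inc) → w , transport inc) (λ (w , inc) → w , transport⁻ inc)) (covered? A v) (covered? B v))
      where
      transport : ∀ {w} → Incident A v w → Incident B v w
      transport {w} (inj₁ h) = inj₁ (trans (sym (proj₁ (agree w))) h)
      transport {w} (inj₂ h) = inj₂ (trans (sym (proj₂ (agree w))) h)
      transport⁻ : ∀ {w} → Incident B v w → Incident A v w
      transport⁻ {w} (inj₁ h) = inj₁ (trans (proj₁ (agree w)) h)
      transport⁻ {w} (inj₂ h) = inj₂ (trans (proj₂ (agree w)) h)

    busy≤degree : ∀ A {v} → v < n → ind (busy A v) ≤ degree A v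
    busy≤degree A {v} v<n with covered? A v
    ... | yes (w , inc) = ≤-trans (one≤ inc) (∑-term n (λ w → ind (A (v , w)) + ind (A (w , v))) (toℕ<n w))
      where
      one≤ : ∀ {w} → Incident A v w → 1 ≤ ind (A (v , w)) + ind (A (w , v))
      one≤ (inj₁ h) rewrite h = s≤s z≤n
      one≤ {w} (inj₂ h) rewrite h = m≤n+m 1 (ind (A (v , w)))
    ... | no _ rewrite dec-false (n ≤? v) (<⇒≱ v<n) = z≤n

  bounded-insert : ∀ {A p q} → Bounded n A → p < n → q < n → Bounded n (A [ (p , q) ]≔ true)
  bounded-insert bounded p<n q<n h with update-true h
  ... | inj₁ (refl , _) = p<n , q<n
  ... | inj₂ (_ , Ax)   = bounded Ax

  bounded-delete : ∀ {A e} → Bounded n A → Bounded n (A [ e ]≔ false)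
  bounded-delete bounded h with update-true h
  ... | inj₂ (_ , Ax) = bounded Ax

  vA vB vC : ℕ → ℕ
  vA t = 3 * t
  vB t = 1 + 3 * t
  vC t = 2 + 3 * t

  ends : ℕ → Side → ℕ × ℕ
  ends t AB = vA t , vB t
  ends t BC = vB t , vC t
  ends t AC = vA t , vC t

  local : Graph → ℕ → Local
  local A t = block (A (ends t AB)) (A (ends t BC)) (A (ends t AC)) (busy A (vA t)) (busy A (vB t)) (busy A (vC t))

  local-edge : ∀ A t s → edge (local A t) s ≡ A (ends t s)
  local-edge A t AB = refl
  local-edge A t BC = refl
  local-edge A t AC = refl

  private
    vA≢vB : ∀ t → vA t ≢ vB t
    vA≢vB t = <⇒≢ (n<1+n _)

    vB≢vC : ∀ t → vB t ≢ vC t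
    vB≢vC t = <⇒≢ (n<1+n _)

    vA≢vC : ∀ t → vA t ≢ vC t
    vA≢vC t = <⇒≢ (m<n⇒m<1+n (n<1+n _))

    block-index : ∀ r t → r < 3 → (r + 3 * t) / 3 ≡ t
    block-index r t r<3 = begin
      (r + 3 * t) / 3      ≡⟨ +-distrib-/-∣ʳ r (m∣m*n t) ⟩
      r / 3 + 3 * t / 3    ≡⟨ cong₂ _+_ (m<n⇒m/n≡0 r<3) (cong (_/ 3) (*-comm 3 t)) ⟩
      t * 3 / 3            ≡⟨ m*n/n≡m t 3 ⟩
      t                    ∎
      where open ≡-Reasoning

    corners-in-block : ∀ t → vA t / 3 ≡ t × vB t / 3 ≡ t × vC t / 3 ≡ t
    corners-in-block t = block-index 0 t (s≤s z≤n) , block-index 1 t (s≤s (s≤s z≤n)) , block-index 2 t ≤-refl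

    ends-in-block : ∀ t x → proj₁ (ends t x) / 3 ≡ t × proj₂ (ends t x) / 3 ≡ t
    ends-in-block t AB = proj₁ (corners-in-block t) , proj₁ (proj₂ (corners-in-block t))
    ends-in-block t BC = proj₂ (corners-in-block t)
    ends-in-block t AC = proj₁ (corners-in-block t) , proj₂ (proj₂ (corners-in-block t))

    apart : ∀ {v w s t} → v / 3 ≡ s → w / 3 ≡ t → s ≢ t → v ≢ w
    apart v∈s w∈t s≢t refl = s≢t (trans (sym v∈s) w∈t)

  ends-apart : ∀ {s t} y x → s ≢ t → ends s y ≢ ends t x
  ends-apart {s} {t} y x s≢t = pair-≢ˡ (apart (proj₁ (ends-in-block s y)) (proj₁ (ends-in-block t x)) s≢t)

  ends-ordered : ∀ t s → proj₁ (ends t s) < proj₂ (ends t s)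
  ends-ordered t AB = n<1+n _
  ends-ordered t BC = n<1+n _
  ends-ordered t AC = m<n⇒m<1+n (n<1+n _)

  block-≡ : ∀ {a b c d e f a′ b′ c′ d′ e′ f′} → a ≡ a′ → b ≡ b′ → c ≡ c′ → d ≡ d′ → e ≡ e′ → f ≡ f′ →
            block a b c d e f ≡ block a′ b′ c′ d′ e′ f′
  block-≡ refl refl refl refl refl refl = refl

  local-add : ∀ A t s → Free (local A t) s → local (A [ ends t s ]≔ true) t ≡ add (local A t) s
  local-add A t AB (a-free , b-free) =
    block-≡ update-hit (update-miss (pair-≢ˡ (vA≢vB t ∘ sym))) (update-miss (pair-≢ʳ (vB≢vC t ∘ sym)))
            (busy-intro (free⇒< {A} b-free) (inj₁ update-hit)) (busy-intro (free⇒< {A} a-free) (inj₂ update-hit))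
            (busy-agree (update-agree (vA≢vC t ∘ sym) (vB≢vC t ∘ sym)))
  local-add A t BC (b-free , c-free) =
    block-≡ (update-miss (pair-≢ˡ (vA≢vB t))) update-hit (update-miss (pair-≢ˡ (vA≢vB t)))
            (busy-agree (update-agree (vA≢vB t) (vA≢vC t)))
            (busy-intro (free⇒< {A} c-free) (inj₁ update-hit)) (busy-intro (free⇒< {A} b-free) (inj₂ update-hit))
  local-add A t AC (a-free , c-free) =
    block-≡ (update-miss (pair-≢ʳ (vB≢vC t))) (update-miss (pair-≢ˡ (vA≢vB t ∘ sym))) update-hit
            (busy-intro (free⇒< {A} c-free) (inj₁ update-hit))
            (busy-agree (update-agree (vA≢vB t ∘ sym) (vB≢vC t)))
            (busy-intro (free⇒< {A} a-free) (inj₂ update-hit))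

  local-del : ∀ {A} t s → Matching A → Bounded n A → A (ends t s) ≡ true → local (A [ ends t s ]≔ false) t ≡ del (local A t) s
  local-del {A} t s M bounded h with delete-isolates M h | bounded h
  local-del {A} t AB M bounded h | iso-a , iso-b | a<n , b<n =
    block-≡ update-hit (update-miss (pair-≢ˡ (vA≢vB t ∘ sym))) (update-miss (pair-≢ʳ (vB≢vC t ∘ sym)))
            (isolated⇒free a<n iso-a) (isolated⇒free b<n iso-b)
            (busy-agree (update-agree (vA≢vC t ∘ sym) (vB≢vC t ∘ sym)))
  local-del {A} t BC M bounded h | iso-b , iso-c | b<n , c<n =
    block-≡ (update-miss (pair-≢ˡ (vA≢vB t))) update-hit (update-miss (pair-≢ˡ (vA≢vB t)))
            (busy-agree (update-agree (vA≢vB t) (vA≢vC t)))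
            (isolated⇒free b<n iso-b) (isolated⇒free c<n iso-c)
  local-del {A} t AC M bounded h | iso-a , iso-c | a<n , c<n =
    block-≡ (update-miss (pair-≢ʳ (vB≢vC t))) (update-miss (pair-≢ˡ (vA≢vB t ∘ sym))) update-hit
            (isolated⇒free a<n iso-a)
            (busy-agree (update-agree (vA≢vB t ∘ sym) (vB≢vC t)))
            (isolated⇒free c<n iso-c)

  local-away : ∀ A {s t} x b → s ≢ t → local (A [ ends t x ]≔ b) s ≡ local A s
  local-away A {s} {t} x b s≢t =
    block-≡ (update-miss (ends-apart AB x s≢t)) (update-miss (ends-apart BC x s≢t)) (update-miss (ends-apart AC x s≢t))
            (busy-agree (corner-apart a∈s)) (busy-agree (corner-apart b∈s)) (busy-agree (corner-apart c∈s))
    where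
    a∈s = proj₁ (corners-in-block s)
    b∈s = proj₁ (proj₂ (corners-in-block s))
    c∈s = proj₂ (proj₂ (corners-in-block s))
    corner-apart : ∀ {v} → v / 3 ≡ s → Agree (A [ ends t x ]≔ b) A v
    corner-apart v∈s = update-agree (apart v∈s (proj₁ (ends-in-block t x)) s≢t) (apart v∈s (proj₂ (ends-in-block t x)) s≢t)

  local-cong : ∀ {A B} → A ≗ B → ∀ t → local A t ≡ local B t
  local-cong A≗B t = block-≡ (A≗B _) (A≗B _) (A≗B _) (busy-agree (≗⇒agree A≗B _)) (busy-agree (≗⇒agree A≗B _)) (busy-agree (≗⇒agree A≗B _))

  local-single : ∀ {A} → Matching A → ∀ t → SingleEdge (local A t)
  local-single M t AB AB _ _ = refl
  local-single M t BC BC _ _ = refl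
  local-single M t AC AC _ _ = refl
  local-single M t AB BC h h′ = ⊥-elim (vA≢vC t (partner-unique M (inj₂ h) (inj₁ h′)))
  local-single M t BC AB h h′ = ⊥-elim (vA≢vC t (partner-unique M (inj₂ h′) (inj₁ h)))
  local-single M t AB AC h h′ = ⊥-elim (vB≢vC t (partner-unique M (inj₁ h) (inj₁ h′)))
  local-single M t AC AB h h′ = ⊥-elim (vB≢vC t (partner-unique M (inj₁ h′) (inj₁ h)))
  local-single M t BC AC h h′ = ⊥-elim (vA≢vB t (partner-unique M (inj₂ h′) (inj₂ h)))
  local-single M t AC BC h h′ = ⊥-elim (vA≢vB t (partner-unique M (inj₂ h) (inj₂ h′)))

  local-edges-busy : ∀ {A} → Bounded n A → ∀ t → EdgesBusy (local A t)
  local-edges-busy bounded t AB h = busy-intro (proj₂ (bounded h)) (inj₁ h) , busy-intro (proj₁ (bounded h)) (inj₂ h)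
  local-edges-busy bounded t BC h = busy-intro (proj₂ (bounded h)) (inj₁ h) , busy-intro (proj₁ (bounded h)) (inj₂ h)
  local-edges-busy bounded t AC h = busy-intro (proj₂ (bounded h)) (inj₁ h) , busy-intro (proj₁ (bounded h)) (inj₂ h)

  free-ends : ∀ A t s → Free (local A t) s → busy A (proj₁ (ends t s)) ≡ false × busy A (proj₂ (ends t s)) ≡ false
  free-ends A t AB free = free
  free-ends A t BC free = free
  free-ends A t AC free = free

  Down Up : Graph → ℕ → Set
  Down A t = (∀ s → s < t → critical (local A s) ≡ true) × lower (local A t) ≡ true
  Up   B t = (∀ s → s < t → critical (local B s) ≡ true) × upper (local B t) ≡ true

  pickEdge upEdge : Graph → ℕ → ℕ × ℕ
  pickEdge A t = ends t (pick (local A t))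
  upEdge   B t = ends t (up (local B t))

  module _ {A t} (M : Matching A) (bounded : Bounded n A) (D : Down A t) where

    private
      s = pick (local A t)
      free = free-ends A t s (lower-free (local A t) (proj₂ D))

    pick-absent : A (pickEdge A t) ≡ false
    pick-absent = ¬-not λ h → free⇒isolated bounded (proj₁ free) _ (inj₁ h)

    insert-pick-matching : Matching (A [ pickEdge A t ]≔ true)
    insert-pick-matching =
      insert-matching M (ends-ordered t s) (free⇒isolated bounded (proj₁ free)) (free⇒isolated bounded (proj₂ free))

    insert-pick-bounded : Bounded n (A [ pickEdge A t ]≔ true)
    insert-pick-bounded = bounded-insert bounded (free⇒< (proj₁ free)) (free⇒< (proj₂ free))

    private
      local-inserted : local (A [ pickEdge A t ]≔ true) t ≡ add (local A t) s
      local-inserted = local-add A t s (lower-free (local A t) (proj₂ D))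

      upper-inserted = lower-add-upper (local A t) (proj₂ D)

    insert-pick-up : Up (A [ pickEdge A t ]≔ true) t
    insert-pick-up =
      (λ r r<t → trans (cong critical (local-away A s true (<⇒≢ r<t))) (proj₁ D r r<t)) ,
      trans (cong upper local-inserted) (proj₁ upper-inserted)

    insert-pick-upEdge : upEdge (A [ pickEdge A t ]≔ true) t ≡ pickEdge A t
    insert-pick-upEdge = cong (ends t) (trans (cong up local-inserted) (proj₂ upper-inserted))

  module _ {B t} (M : Matching B) (bounded : Bounded n B) (U : Up B t) where

    private
      s = up (local B t)
      single = local-single M t

    up-present : B (upEdge B t) ≡ true
    up-present = trans (sym (local-edge B t s)) (upper-edge (local B t) single (proj₂ U))

    private
      local-deleted : local (B [ upEdge B t ]≔ false) t ≡ del (local B t) s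
      local-deleted = local-del t s M bounded up-present

      lower-deleted = upper-del-lower (local B t) single (proj₂ U)

    delete-up-down : Down (B [ upEdge B t ]≔ false) t
    delete-up-down =
      (λ r r<t → trans (cong critical (local-away B s false (<⇒≢ r<t))) (proj₁ U r r<t)) ,
      trans (cong lower local-deleted) (proj₁ lower-deleted)

    delete-up-pickEdge : pickEdge (B [ upEdge B t ]≔ false) t ≡ upEdge B t
    delete-up-pickEdge = cong (ends t) (trans (cong pick local-deleted) (proj₂ lower-deleted))

  FirstNoncritical : Graph → ℕ → Set
  FirstNoncritical A t = (∀ s → s < t → critical (local A s) ≡ true) × critical (local A t) ≡ false

  down-first : ∀ {A t} → Down A t → FirstNoncritical A t
  down-first {A} {t} (below , L) = below , lower⇒noncritical (local A t) L

  up-first : ∀ {A t} → Up A t → FirstNoncritical A t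
  up-first {A} {t} (below , U) = below , upper⇒noncritical (local A t) U

  first-noncritical-unique : ∀ {A t t′} → FirstNoncritical A t → FirstNoncritical A t′ → t ≡ t′
  first-noncritical-unique (below , nc) (below′ , nc′) =
    least-unique below (λ c → true≢false (trans (sym c) nc)) below′ (λ c → true≢false (trans (sym c) nc′))

  down⇒¬up : ∀ {A t t′} → Down A t → ¬ Up A t′
  down⇒¬up {A} {t} D U with first-noncritical-unique {A} (down-first {A} D) (up-first {A} U)
  ... | refl = true≢false (trans (sym (proj₂ U)) (lower⇒¬upper (local A t) (proj₂ D)))

  up-away : ∀ {B t s} y b → t < s → Up B t → Up (B [ ends s y ]≔ b) t
  up-away {B} {t} y b t<s (below , U) =
    (λ r r<t → trans (cong critical (local-away B y b (<⇒≢ (<-trans r<t t<s)))) (below r r<t)) ,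
    trans (cong upper (local-away B y b (<⇒≢ t<s))) U

  down-≗ : ∀ {A B t} → A ≗ B → Down A t → Down B t
  down-≗ {t = t} A≗B (below , L) =
    (λ s s<t → trans (cong critical (sym (local-cong A≗B s))) (below s s<t)) , trans (cong lower (sym (local-cong A≗B t))) L

  up-≗ : ∀ {A B t} → A ≗ B → Up A t → Up B t
  up-≗ {t = t} A≗B (below , U) =
    (λ s s<t → trans (cong critical (sym (local-cong A≗B s))) (below s s<t)) , trans (cong upper (sym (local-cong A≗B t))) U

  record V (α β : EdgeSet n) : Set where
    field
      matching : IsMatching α
      pivot    : ℕ
      down     : Down (adjacency α) pivot
      inserted : adjacency β ≗ adjacency α [ pickEdge (adjacency α) pivot ]≔ true

  module _ {α β} (v : V α β) where

    open V v
    private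
      A = adjacency α
      B = adjacency β
      M = IsMatching⇒Matching α matching
      bounded = adjacency-bounded α
      e = pickEdge A pivot

    V-upper-matching : IsMatching β
    V-upper-matching = Matching⇒IsMatching β (matching-≗ (λ x → sym (inserted x)) (insert-pick-matching M bounded down))

    V-⊊ : α ⊊ β
    V-⊊ = adjacency-⊑⇒⊆ {S = α} {T = β} (λ h → trans (inserted _) (⊑-insert h)) ,
          λ α≡β → true≢false (trans (sym (trans (inserted e) update-hit)) (trans (cong (λ γ → adjacency γ e) (sym α≡β)) (pick-absent M bounded down)))

    V-size : size β ≡ suc (size α)
    V-size = begin
      size β                       ≡⟨ size≡count β ⟩
      count n B                    ≡⟨ count-≗ n inserted ⟩
      count n (A [ e ]≔ true)      ≡⟨ count-insert n (proj₁ e<n) (proj₂ e<n) (pick-absent M bounded down) ⟩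
      suc (count n A)              ≡⟨ cong suc (size≡count α) ⟨
      suc (size α)                 ∎
      where
      open ≡-Reasoning
      e<n = insert-pick-bounded M bounded down update-hit

    V-up : Up B pivot
    V-up = up-≗ (sym ∘ inserted) (insert-pick-up M bounded down)

    V-deleted : A ≗ B [ upEdge B pivot ]≔ false
    V-deleted x = begin
      A x                                ≡⟨ update-restore (pick-absent M bounded down) x ⟨
      ((A [ e ]≔ true) [ e ]≔ false) x   ≡⟨ update-cong (sym ∘ inserted) e false x ⟩
      (B [ e ]≔ false) x                 ≡⟨ cong (λ f → (B [ f ]≔ false) x) upEdge≡e ⟨
      (B [ upEdge B pivot ]≔ false) x    ∎
      where
      open ≡-Reasoning
      upEdge≡e : upEdge B pivot ≡ e
      upEdge≡e = trans (cong (ends pivot ∘ up) (local-cong inserted pivot)) (insert-pick-upEdge M bounded down)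

  V-unique : ∀ σ α β α′ β′ → V α β → V α′ β′ → InPair σ α β → InPair σ α′ β′ → α ≡ α′ × β ≡ β′
  V-unique σ _ _ _ _ v v′ (inj₁ refl) (inj₁ refl) =
    refl , adjacency-injective λ x → trans (V.inserted v x) (trans (cong (λ t → (A [ pickEdge A t ]≔ true) x) same-pivot) (sym (V.inserted v′ x)))
    where
    A = adjacency σ
    same-pivot = first-noncritical-unique {A} (down-first {A} (V.down v)) (down-first {A} (V.down v′))
  V-unique σ _ _ _ _ v v′ (inj₂ refl) (inj₂ refl) =
    adjacency-injective (λ x → trans (V-deleted v x) (trans (cong (λ t → (B [ upEdge B t ]≔ false) x) same-pivot) (sym (V-deleted v′ x)))) , refl
    where
    B = adjacency σ
    same-pivot = first-noncritical-unique {B} (up-first {B} (V-up v)) (up-first {B} (V-up v′))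
  V-unique σ _ _ _ _ v v′ (inj₁ refl) (inj₂ refl) = ⊥-elim (down⇒¬up {adjacency σ} (V.down v) (V-up v′))
  V-unique σ _ _ _ _ v v′ (inj₂ refl) (inj₁ refl) = ⊥-elim (down⇒¬up {adjacency σ} (V.down v′) (V-up v))

  V-discrete : IsDiscreteVectorField V
  V-discrete = (λ α β v → V.matching v , V-upper-matching v , V-⊊ v , V-size v) , V-unique

  profile : EdgeSet n → ℕ → Bool
  profile α t = hasInternal (local (adjacency α) t)

  module _ {α β α′ β′} (v : V α β) (v′ : V α′ β′) (α′⊊β : α′ ⊊ β) (α′≢α : α′ ≢ α) (same-size : size α′ ≡ size α) where

    private
      A  = adjacency α
      B  = adjacency β
      A′ = adjacency α′
      t  = V.pivot v
      e  = pickEdge A t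
      A′⊑B : A′ ⊑ B
      A′⊑B = ⊆⇒adjacency-⊑ {S = α′} {T = β} (proj₁ α′⊊β)
      count-A′ : count n A′ ≡ count n A
      count-A′ = trans (sym (size≡count α′)) (trans same-size (size≡count α))
      count-B : count n B ≡ suc (count n A)
      count-B = trans (sym (size≡count β)) (trans (V-size v) (cong suc (size≡count α)))

    pick-kept : A′ e ≡ true
    pick-kept with A′ e in A′e
    ... | true  = refl
    ... | false = ⊥-elim (α′≢α (adjacency-injective (count-⊑-≡ n (adjacency-bounded α) A′⊑A count-A′)))
      where
      A′⊑A : A′ ⊑ A
      A′⊑A {x} h with update-true (trans (sym (V.inserted v x)) (A′⊑B h))
      ... | inj₁ (refl , _) = ⊥-elim (false≢true (trans (sym A′e) h))
      ... | inj₂ (_ , Ax)   = Ax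

    private
      B≡A : ∀ s → t < s → ∀ y → B (ends s y) ≡ A (ends s y)
      B≡A s t<s y = trans (V.inserted v (ends s y)) (update-miss (ends-apart y (pick (local A t)) (<⇒≢ t<s ∘ sym)))

    -- Were an edge f of α in a later block missing from α′, then α′ = β − f would be paired downwards.
    later-blocks-kept : ∀ s → t < s → ∀ y → A (ends s y) ≡ A′ (ends s y)
    later-blocks-kept s t<s y with A′ (ends s y) in A′f
    ... | true  = trans (sym (B≡A s t<s y)) (A′⊑B A′f)
    ... | false = ¬-not λ Af → dropped (trans (B≡A s t<s y) Af)
      where
      f = ends s y
      dropped : B f ≡ true → ⊥
      dropped Bf = down⇒¬up {A′} (V.down v′) (up-≗ (sym ∘ A′≗C) (up-away y false t<s (V-up v)))
        where
        C = B [ f ]≔ false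
        A′⊑C : A′ ⊑ C
        A′⊑C {x} h with x ≟ₑ f
        ... | yes refl = ⊥-elim (false≢true (trans (sym A′f) h))
        ... | no  x≢f  = trans (update-miss x≢f) (A′⊑B h)
        f<n = adjacency-bounded β Bf
        A′≗C : A′ ≗ C
        A′≗C = count-⊑-≡ n (bounded-delete (adjacency-bounded β)) A′⊑C
                 (suc-injective (trans (cong suc count-A′) (trans (sym count-B) (count-delete n (proj₁ f<n) (proj₂ f<n) Bf))))

    profile-increases : profile α <colex profile α′
    profile-increases =
      t , lower⇒¬internal (local A t) (proj₂ (V.down v)) ,
      edge⇒internal (local A′ t) (pick (local A t)) (trans (local-edge A′ t _) pick-kept) ,
      λ s t<s → cong₂ _∨_ (later-blocks-kept s t<s AB) (cong₂ _∨_ (later-blocks-kept s t<s BC) (later-blocks-kept s t<s AC))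

  V-acyclic : ¬ ClosedPath V
  V-acyclic (k , α , β , d , sizes , steps , closed) =
    <colex-irrefl (profile (α 0)) (subst (λ γ → profile (α 0) <colex profile γ) closed (chain k ≤-refl))
    where
    paired-up : ∀ i → i ≤ k → Σ (EdgeSet n) (V (α (suc i)))
    paired-up i i≤k with m≤n⇒m<n∨m≡n i≤k
    ... | inj₁ i<k  = β (suc i) , proj₁ (steps (suc i) i<k)
    ... | inj₂ refl = β 0 , subst (λ γ → V γ (β 0)) (sym closed) (proj₁ (steps 0 z≤n))
    step : ∀ i → i ≤ k → profile (α i) <colex profile (α (suc i))
    step i i≤k = profile-increases (proj₁ (steps i i≤k)) (proj₂ (paired-up i i≤k)) (proj₁ (proj₂ (steps i i≤k)))
                        (proj₂ (proj₂ (steps i i≤k))) (trans (sizes (suc i) (s≤s i≤k)) (sym (sizes i (m≤n⇒m≤1+n i≤k))))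
    chain : ∀ i → i ≤ k → profile (α 0) <colex profile (α (suc i))
    chain zero    i≤k = step 0 i≤k
    chain (suc i) i≤k = <colex-trans (chain i (<⇒≤ i≤k)) (step (suc i) i≤k)

  V-gradient : IsGradientVectorField V
  V-gradient = V-discrete , V-acyclic

  partner-up : ∀ {α t} → IsMatching α → Down (adjacency α) t → Σ (EdgeSet n) (V α)
  partner-up {α} {t} Mα D = toEdgeSet (A [ pickEdge A t ]≔ true) , record
    { matching = Mα ; pivot = t ; down = D
    ; inserted = adjacency-toEdgeSet (insert-pick-bounded (IsMatching⇒Matching α Mα) (adjacency-bounded α) D)
    }
    where A = adjacency α

  partner-down : ∀ {β t} → IsMatching β → Up (adjacency β) t → Σ (EdgeSet n) λ α → V α β
  partner-down {β} {t} Mβ U = α , record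
    { matching = Matching⇒IsMatching α (matching-≗ (sym ∘ A≗) (delete-matching M))
    ; pivot    = t
    ; down     = down-≗ (sym ∘ A≗) (delete-up-down M bounded U)
    ; inserted = inserted
    }
    where
    B = adjacency β
    M = IsMatching⇒Matching β Mβ
    bounded = adjacency-bounded β
    u = upEdge B t
    α = toEdgeSet (B [ u ]≔ false)
    A = adjacency α
    A≗ : A ≗ B [ u ]≔ false
    A≗ = adjacency-toEdgeSet (bounded-delete bounded)
    pick≡u : pickEdge A t ≡ u
    pick≡u = trans (cong (ends t ∘ pick) (local-cong A≗ t)) (delete-up-pickEdge M bounded U)
    inserted : B ≗ A [ pickEdge A t ]≔ true
    inserted x = begin
      B x                                ≡⟨ update-restore (up-present M bounded U) x ⟨
      ((B [ u ]≔ false) [ u ]≔ true) x   ≡⟨ update-cong (sym ∘ A≗) u true x ⟩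
      (A [ u ]≔ true) x                  ≡⟨ cong (λ f → (A [ f ]≔ true) x) pick≡u ⟨
      (A [ pickEdge A t ]≔ true) x       ∎
      where open ≡-Reasoning

  unpaired⇒critical : ∀ {α} → IsMatching α → ¬ (∃[ β ] V α β) → ¬ (∃[ γ ] V γ α) →
                      ∀ t → critical (local (adjacency α) t) ≡ true
  unpaired⇒critical {α} Mα no-up no-down t = this t (below t)
    where
    A = adjacency α
    this : ∀ t → (∀ s → s < t → critical (local A s) ≡ true) → critical (local A t) ≡ true
    this t earlier with lower (local A t) in L | upper (local A t) in U
    ... | true  | _     = ⊥-elim (no-up (partner-up Mα (earlier , L)))
    ... | false | true  = ⊥-elim (no-down (partner-down Mα (earlier , U)))
    ... | false | false = refl
    below : ∀ t s → s < t → critical (local A s) ≡ true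
    below (suc t) s s<1+t with m≤n⇒m<n∨m≡n (≤-pred s<1+t)
    ... | inj₁ s<t  = below t s s<t
    ... | inj₂ refl = this s (below s)

  ∑-degree : ∀ A → ∑[ v < n ] degree A v ≡ count n A + count n A
  ∑-degree A = begin
    ∑[ v < n ] degree A v                                                     ≡⟨ ∑-cong n (λ v _ → ∑-+ n _ _) ⟩
    ∑[ v < n ] (∑[ w < n ] ind (A (v , w)) + ∑[ w < n ] ind (A (w , v)))      ≡⟨ ∑-+ n _ _ ⟩
    count n A + ∑[ v < n ] ∑[ w < n ] ind (A (w , v))                         ≡⟨ cong (count n A +_) (∑-swap n n λ v w → ind (A (w , v))) ⟩
    count n A + count n A                                                     ∎
    where open ≡-Reasoning

  -- Among the busy vertices of the blocks, only the phantom vertex n is not covered by A.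
  all-critical⇒large : ∀ {A} → Bounded n A → (∀ t → critical (local A t) ≡ true) → suc n / 3 ≤ count n A
  all-critical⇒large {A} bounded critical-everywhere = half twice-bound
    where
    K = suc n / 3
    f = λ v → ind (busy A v)
    3K≤1+n : 3 * K ≤ suc n
    3K≤1+n = subst (_≤ suc n) (*-comm K 3) (m/n*n≤m (suc n) 3)
    twice-bound : 2 * K ≤ suc (count n A + count n A)
    twice-bound = begin
      2 * K                           ≤⟨ ∑-triples K f (λ t _ → critical⇒two-busy (local A t) (local-edges-busy bounded t) (critical-everywhere t)) ⟩
      ∑ (3 * K) f                     ≤⟨ ∑-≤-range f 3K≤1+n ⟩
      ∑ n f + f n                     ≤⟨ +-mono-≤ (∑-mono n λ v v<n → busy≤degree A v<n) (ind≤1 (busy A n)) ⟩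
      ∑[ v < n ] degree A v + 1       ≡⟨ cong (_+ 1) (∑-degree A) ⟩
      count n A + count n A + 1       ≡⟨ +-comm _ 1 ⟩
      suc (count n A + count n A)     ∎
      where open ≤-Reasoning
    half : ∀ {k c} → 2 * k ≤ suc (c + c) → k ≤ c
    half {k} {c} h = ≮⇒≥ λ c<k → <-irrefl refl (begin-strict
      suc (c + c)        <⟨ n<1+n _ ⟩
      suc (suc (c + c))  ≡⟨ trans (*-suc 2 c) (cong (λ x → 2 + (c + x)) (+-identityʳ c)) ⟨
      2 * suc c          ≤⟨ *-monoʳ-≤ 2 c<k ⟩
      2 * k              ≤⟨ h ⟩
      suc (c + c)        ∎)
      where open ≤-Reasoning

  unpaired⇒large : ∀ {α} → IsMatching α → ¬ (∃[ β ] V α β) → ¬ (∃[ γ ] V γ α) → suc n / 3 ≤ size α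
  unpaired⇒large {α} Mα no-up no-down =
    subst (suc n / 3 ≤_) (sym (size≡count α)) (all-critical⇒large (adjacency-bounded α) (unpaired⇒critical Mα no-up no-down))

  private
    empty-entry : ∀ i j → lookup (lookup (empty {n}) i) j ≡ false
    empty-entry i j = trans (cong (λ r → lookup r j) (lookup-replicate i _)) (lookup-replicate j false)

  adjacency-empty : adjacency (empty {n}) ≗ λ _ → false
  adjacency-empty x = ¬-not λ h → case adjacency⇒∋ (empty {n}) h of λ where
    (i , j , _ , _ , ∋ij) → false≢true (trans (sym (empty-entry i j)) ∋ij)

  empty-matching : IsMatching (empty {n})
  empty-matching = Matching⇒IsMatching empty (matching-≗ (sym ∘ adjacency-empty) edgeless-matching)

  size-empty : size (empty {n}) ≡ 0
  size-empty = trans (size≡count (empty {n})) (trans (count-≗ n adjacency-empty) (trans (∑-cong n λ _ _ → ∑-zero n) (∑-zero n)))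

  empty-down : 1 < n → Down (adjacency (empty {n})) 0
  empty-down 1<n = (λ _ ()) , cong lower local-empty
    where
    E = adjacency (empty {n})
    isolated : ∀ v → Isolated E v
    isolated v w (inj₁ h) = false≢true (trans (sym (adjacency-empty _)) h)
    isolated v w (inj₂ h) = false≢true (trans (sym (adjacency-empty _)) h)
    local-empty : local E 0 ≡ block false false false false false (busy E 2)
    local-empty = block-≡ (adjacency-empty _) (adjacency-empty _) (adjacency-empty _)
                          (isolated⇒free (<-trans (s≤s z≤n) 1<n) (isolated 0)) (isolated⇒free 1<n (isolated 1)) refl

theorem1p2 : (n : ℕ) → 5 ≤ n →
    Σ (PairSet n) λ V → IsGradientVectorField V
      × Σ (EdgeSet n) λ c → Critical V c × size c ≡ 1
          × (∀ α → Critical V α → size α ≤ ν n → α ≡ c)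
theorem1p2 n 5≤n = V , V-gradient , c , critical-c , size-c , only-c
  where
  open BlockMatching n
  paired-with-empty : Σ (EdgeSet n) (V empty)
  paired-with-empty = partner-up empty-matching (empty-down (≤-trans (s≤s (s≤s z≤n)) 5≤n))
  c = proj₁ paired-with-empty
  v-c = proj₂ paired-with-empty
  size-c : size c ≡ 1
  size-c = trans (V-size v-c) (cong suc size-empty)
  critical-c : Critical V c
  critical-c = V-upper-matching v-c , ≤-reflexive (sym size-c) , inj₂ (size-c , v-c)
  only-c : ∀ α → Critical V α → size α ≤ ν n → α ≡ c
  only-c α (_ , _ , inj₂ (_ , v-α)) _ = proj₂ (V-unique empty _ _ _ _ v-α v-c (inj₁ refl) (inj₁ refl))
  only-c α (Mα , _ , inj₁ (no-up , no-down)) small =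
    ⊥-elim (k≰k∸1 (≤-trans (s≤s z≤n) (/-monoˡ-≤ 3 (s≤s 5≤n))) (≤-trans (unpaired⇒large Mα no-up no-down) small))
    where
    k≰k∸1 : ∀ {k} → 1 ≤ k → ¬ k ≤ k ∸ 1
    k≰k∸1 {suc k} _ k<k = <-irrefl refl k<k
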